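{- For integers $j\ge0$, $m\ge1$, $r\in\{0,\ldots,m-1\}$ and $k\ge0$, let $S^{(m)}(mj+r,k)$ be the number of $k$-element subsets of $\{1,\ldots,mj+r\}$ such that no two elements of the subset differ by $m$. Then \[ S^{(m)}(mj+r,k)=[x^k]\,f_{j+1}(x)^{m-r}f_{j+2}(x)^r. \]
   Context: The Fibonacci polynomials are defined by $f_n(x)=f_{n-1}(x)+xf_{n-2}(x)+\delta_{n,0}$ with $f_n(x)=0$ for $n<0$, where $\delta_{i,j}$ is $1$ if $i=j$ and $0$ otherwise. $[x^k]$ extracts the coefficient of $x^k$. -}

module Defs where

open import Data.Nat using (ℕ; zero; suc; _+_; _*_; _≟_)
open import Data.Nat.Properties using ()
open import Data.Bool using (Bool; true; false)
open import Data.List using (List; []; _∷_; map; _++_; filter; length)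
open import Data.Vec using (Vec; []; _∷_)
open import Data.Fin using (Fin; toℕ)
open import Data.Fin.Subset using (Subset; _∈_; ∣_∣)
open import Data.Fin.Subset.Properties using (_∈?_)
open import Data.Fin.Properties using (all?)
open import Data.Product using (_×_)
open import Relation.Nullary using (¬_; Dec; yes; no)
open import Relation.Nullary.Decidable using (_×-dec_; _→-dec_; ¬?)
open import Relation.Binary.PropositionalEquality using (_≡_)

-- Polynomials in ℕ[x] as coefficient lists, lowest degree first.

Poly : Set
Poly = List ℕ

coeff : ℕ → Poly → ℕ
coeff k       []       = 0
coeff zero    (a ∷ p)  = a
coeff (suc k) (a ∷ p)  = coeff k p

_⊕_ : Poly → Poly → Poly
[]      ⊕ q       = q
p       ⊕ []      = p
(a ∷ p) ⊕ (b ∷ q) = (a + b) ∷ (p ⊕ q)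

scale : ℕ → Poly → Poly
scale c = map (c *_)

_⊗_ : Poly → Poly → Poly
[]      ⊗ q = []
(a ∷ p) ⊗ q = scale a q ⊕ (0 ∷ (p ⊗ q))

one : Poly
one = 1 ∷ []

_^ᴾ_ : Poly → ℕ → Poly
p ^ᴾ zero  = one
p ^ᴾ suc n = p ⊗ (p ^ᴾ n)

shiftX : Poly → Poly
shiftX p = 0 ∷ p

-- Fibonacci polynomials: f_n = f_{n-1} + x f_{n-2} + δ_{n,0}, f_n = 0 for n < 0.
-- Hence f_0 = 1, f_1 = f_0 = 1, f_{n+2} = f_{n+1} + x f_n.
fib : ℕ → Poly
fib zero          = one
fib (suc zero)    = one
fib (suc (suc n)) = fib (suc n) ⊕ shiftX (fib n)

-- Subsets of {1,…,N}, represented as subsets of Fin N (element i ↔ i+1).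

allSubsets : (n : ℕ) → List (Subset n)
allSubsets zero    = [] ∷ []
allSubsets (suc n) = map (false ∷_) (allSubsets n) ++ map (true ∷_) (allSubsets n)

NoDiff : (m : ℕ) {n : ℕ} → Subset n → Set
NoDiff m {n} p = (i j : Fin n) → i ∈ p → j ∈ p → ¬ (toℕ j ≡ toℕ i + m)

noDiff? : (m : ℕ) {n : ℕ} (p : Subset n) → Dec (NoDiff m p)
noDiff? m p = all? λ i → all? λ j →
  (i ∈? p) →-dec ((j ∈? p) →-dec ¬? (toℕ j ≟ toℕ i + m))

Good : (m k : ℕ) {n : ℕ} → Subset n → Set
Good m k p = (∣ p ∣ ≡ k) × NoDiff m p

good? : (m k : ℕ) {n : ℕ} (p : Subset n) → Dec (Good m k p)
good? m k p = (∣ p ∣ ≟ k) ×-dec noDiff? m p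

S : (m n k : ℕ) → ℕ
S m n k = length (filter (good? m k) (allSubsets n))

-- The residue classes modulo m cut {1,…,mj+r} into r paths with j+1 vertices and
-- m−r paths with j vertices, and two elements differ by m exactly when they are
-- adjacent on one of these paths.  So the subsets in question are the independent
-- sets of a disjoint union of paths, and f_{ℓ+1} is the independence polynomial of
-- a path with ℓ vertices.  Concretely, the positions are scanned from left to right
-- while remembering which of the last m positions were chosen; a chosen one blocks
-- the first remaining vertex of its path, and the one-step recurrence of the
-- resulting generating polynomial is the Fibonacci recurrence.

module Submission where

open import Defs
open import Level using (0ℓ)
open import Function using (id; _∘_; _⇔_; mk⇔; Equivalence)
open import Data.Nat using (ℕ; zero; suc; _+_; _*_; _∸_; _≤_; _<_; _≥_; _≟_; z≤n; s≤s)
open import Data.Nat.Properties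
  using (+-comm; +-assoc; +-identityʳ; *-comm; *-assoc; *-zeroʳ; *-identityˡ;
         *-distribˡ-+; *-distribʳ-+; suc-injective; ≤-refl; <⇒≤; m≤n⇒m≤1+n)
open import Data.Bool using (Bool; true; false; T; not; _∧_; if_then_else_)
open import Data.List using (List; []; _∷_; map; length; filter; _++_)
open import Data.List.Properties using (length-++; filter-++; filter-none; filter-≐)
open import Data.List.Relation.Unary.All using (universal)
open import Data.Vec using (Vec; []; _∷_; _∷ʳ_; replicate; here; there)
open import Data.Fin using (Fin; zero; suc; toℕ)
open import Data.Fin.Subset using (Subset; _∈_; ∣_∣)
open import Data.Product using (_×_; _,_; proj₁; proj₂; ∃-syntax; map₁; map₂)
open import Data.Sum using (_⊎_; inj₁; inj₂; [_,_]) renaming (map to map-⊎)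
open import Data.Empty using (⊥)
open import Relation.Nullary using (¬_; does)
open import Relation.Nullary.Decidable using (_×-dec_; T?)
open import Relation.Unary using (Pred; Decidable; _≐_)
open import Relation.Binary using (Setoid; IsEquivalence)
open import Relation.Binary.PropositionalEquality
  using (_≡_; refl; sym; trans; cong; cong₂; subst; module ≡-Reasoning)
open import Algebra.Bundles using (CommutativeSemigroup)
import Algebra.Properties.CommutativeSemigroup as CommutativeSemigroupProperties
import Relation.Binary.Reasoning.Setoid as SetoidReasoning

private
  variable
    m n : ℕ

-- ℕ[x] as a commutative semiring

-- Coefficient lists may end in zeros, so polynomials are compared coefficientwise.
infix 4 _≈_
record _≈_ (p q : Poly) : Set where
  constructor mk≈
  field coeff≡ : ∀ k → coeff k p ≡ coeff k q
open _≈_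

≈-isEquivalence : IsEquivalence _≈_
≈-isEquivalence = record
  { refl  = mk≈ λ k → refl
  ; sym   = λ p≈q → mk≈ λ k → sym (p≈q .coeff≡ k)
  ; trans = λ p≈q q≈r → mk≈ λ k → trans (p≈q .coeff≡ k) (q≈r .coeff≡ k)
  }

≈-setoid : Setoid 0ℓ 0ℓ
≈-setoid = record { isEquivalence = ≈-isEquivalence }

open IsEquivalence ≈-isEquivalence
  using () renaming (refl to ≈-refl; sym to ≈-sym; trans to ≈-trans)
module ≈-Reasoning = SetoidReasoning ≈-setoid

coeff-⊕ : ∀ k p q → coeff k (p ⊕ q) ≡ coeff k p + coeff k q
coeff-⊕ k       []      q       = refl
coeff-⊕ k       (a ∷ p) []      = sym (+-identityʳ _)
coeff-⊕ zero    (a ∷ p) (b ∷ q) = refl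
coeff-⊕ (suc k) (a ∷ p) (b ∷ q) = coeff-⊕ k p q

coeff-scale : ∀ k c p → coeff k (scale c p) ≡ c * coeff k p
coeff-scale k       c []      = sym (*-zeroʳ c)
coeff-scale zero    c (a ∷ p) = refl
coeff-scale (suc k) c (a ∷ p) = coeff-scale k c p

∷-cong : ∀ {a b p q} → a ≡ b → p ≈ q → a ∷ p ≈ b ∷ q
∷-cong a≡b p≈q .coeff≡ zero    = a≡b
∷-cong a≡b p≈q .coeff≡ (suc k) = p≈q .coeff≡ k

0∷-zero : ∀ {p} → p ≈ [] → 0 ∷ p ≈ []
0∷-zero p≈[] .coeff≡ zero    = refl
0∷-zero p≈[] .coeff≡ (suc k) = p≈[] .coeff≡ k

⊕-cong : ∀ {p p′ q q′} → p ≈ p′ → q ≈ q′ → p ⊕ q ≈ p′ ⊕ q′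
⊕-cong {p} {p′} {q} {q′} p≈p′ q≈q′ .coeff≡ k = begin
  coeff k (p ⊕ q)           ≡⟨ coeff-⊕ k p q ⟩
  coeff k p + coeff k q     ≡⟨ cong₂ _+_ (p≈p′ .coeff≡ k) (q≈q′ .coeff≡ k) ⟩
  coeff k p′ + coeff k q′   ≡⟨ coeff-⊕ k p′ q′ ⟨
  coeff k (p′ ⊕ q′)         ∎
  where open ≡-Reasoning

⊕-congˡ : ∀ {p p′} q → p ≈ p′ → p ⊕ q ≈ p′ ⊕ q
⊕-congˡ q p≈p′ = ⊕-cong p≈p′ (≈-refl {q})

⊕-congʳ : ∀ p {q q′} → q ≈ q′ → p ⊕ q ≈ p ⊕ q′
⊕-congʳ p = ⊕-cong (≈-refl {p})

⊕-comm : ∀ p q → p ⊕ q ≈ q ⊕ p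
⊕-comm p q .coeff≡ k = begin
  coeff k (p ⊕ q)         ≡⟨ coeff-⊕ k p q ⟩
  coeff k p + coeff k q   ≡⟨ +-comm (coeff k p) _ ⟩
  coeff k q + coeff k p   ≡⟨ coeff-⊕ k q p ⟨
  coeff k (q ⊕ p)         ∎
  where open ≡-Reasoning

⊕-assoc : ∀ p q r → (p ⊕ q) ⊕ r ≈ p ⊕ (q ⊕ r)
⊕-assoc p q r .coeff≡ k = begin
  coeff k ((p ⊕ q) ⊕ r)                  ≡⟨ coeff-⊕ k (p ⊕ q) r ⟩
  coeff k (p ⊕ q) + coeff k r            ≡⟨ cong (_+ coeff k r) (coeff-⊕ k p q) ⟩
  coeff k p + coeff k q + coeff k r      ≡⟨ +-assoc (coeff k p) _ _ ⟩
  coeff k p + (coeff k q + coeff k r)    ≡⟨ cong (coeff k p +_) (coeff-⊕ k q r) ⟨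
  coeff k p + coeff k (q ⊕ r)            ≡⟨ coeff-⊕ k p (q ⊕ r) ⟨
  coeff k (p ⊕ (q ⊕ r))                  ∎
  where open ≡-Reasoning

⊕-identityʳ : ∀ p → p ⊕ [] ≈ p
⊕-identityʳ []      = ≈-refl
⊕-identityʳ (a ∷ p) = ≈-refl

⊕-commutativeSemigroup : CommutativeSemigroup 0ℓ 0ℓ
⊕-commutativeSemigroup = record
  { _≈_                    = _≈_
  ; _∙_                    = _⊕_
  ; isCommutativeSemigroup = record
    { isSemigroup = record
      { isMagma = record { isEquivalence = ≈-isEquivalence ; ∙-cong = ⊕-cong }
      ; assoc   = ⊕-assoc
      }
    ; comm = ⊕-comm
    }
  }

open CommutativeSemigroupProperties ⊕-commutativeSemigroup
  using () renaming (interchange to ⊕-interchange; x∙yz≈y∙xz to ⊕-leftSwap)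

scale-cong : ∀ c {p q} → p ≈ q → scale c p ≈ scale c q
scale-cong c {p} {q} p≈q .coeff≡ k =
  trans (coeff-scale k c p) (trans (cong (c *_) (p≈q .coeff≡ k)) (sym (coeff-scale k c q)))

scale-zero : ∀ p → scale 0 p ≈ []
scale-zero p .coeff≡ k = coeff-scale k 0 p

scale-identity : ∀ p → scale 1 p ≈ p
scale-identity p .coeff≡ k = trans (coeff-scale k 1 p) (*-identityˡ (coeff k p))

scale-distribʳ : ∀ a b p → scale (a + b) p ≈ scale a p ⊕ scale b p
scale-distribʳ a b p .coeff≡ k = begin
  coeff k (scale (a + b) p)                      ≡⟨ coeff-scale k (a + b) p ⟩
  (a + b) * coeff k p                            ≡⟨ *-distribʳ-+ (coeff k p) a b ⟩
  a * coeff k p + b * coeff k p                  ≡⟨ cong₂ _+_ (coeff-scale k a p) (coeff-scale k b p) ⟨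
  coeff k (scale a p) + coeff k (scale b p)      ≡⟨ coeff-⊕ k (scale a p) (scale b p) ⟨
  coeff k (scale a p ⊕ scale b p)                ∎
  where open ≡-Reasoning

scale-distribˡ : ∀ c p q → scale c (p ⊕ q) ≈ scale c p ⊕ scale c q
scale-distribˡ c p q .coeff≡ k = begin
  coeff k (scale c (p ⊕ q))                      ≡⟨ coeff-scale k c (p ⊕ q) ⟩
  c * coeff k (p ⊕ q)                            ≡⟨ cong (c *_) (coeff-⊕ k p q) ⟩
  c * (coeff k p + coeff k q)                    ≡⟨ *-distribˡ-+ c (coeff k p) _ ⟩
  c * coeff k p + c * coeff k q                  ≡⟨ cong₂ _+_ (coeff-scale k c p) (coeff-scale k c q) ⟨
  coeff k (scale c p) + coeff k (scale c q)      ≡⟨ coeff-⊕ k (scale c p) (scale c q) ⟨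
  coeff k (scale c p ⊕ scale c q)                ∎
  where open ≡-Reasoning

scale-assoc : ∀ a b p → scale (a * b) p ≈ scale a (scale b p)
scale-assoc a b p .coeff≡ k = begin
  coeff k (scale (a * b) p)       ≡⟨ coeff-scale k (a * b) p ⟩
  a * b * coeff k p               ≡⟨ *-assoc a b (coeff k p) ⟩
  a * (b * coeff k p)             ≡⟨ cong (a *_) (coeff-scale k b p) ⟨
  a * coeff k (scale b p)         ≡⟨ coeff-scale k a (scale b p) ⟨
  coeff k (scale a (scale b p))   ∎
  where open ≡-Reasoning

⊗-congʳ : ∀ p {q q′} → q ≈ q′ → p ⊗ q ≈ p ⊗ q′
⊗-congʳ []      q≈q′ = ≈-refl
⊗-congʳ (a ∷ p) q≈q′ = ⊕-cong (scale-cong a q≈q′) (∷-cong refl (⊗-congʳ p q≈q′))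

⊗-zeroʳ : ∀ p → p ⊗ [] ≈ []
⊗-zeroʳ []      = ≈-refl
⊗-zeroʳ (a ∷ p) = 0∷-zero (⊗-zeroʳ p)

⊗-∷ʳ : ∀ p a q → p ⊗ (a ∷ q) ≈ scale a p ⊕ (0 ∷ p ⊗ q)
⊗-∷ʳ []      a q = ≈-sym (0∷-zero ≈-refl)
⊗-∷ʳ (b ∷ p) a q = ∷-cong (cong (_+ 0) (*-comm b a)) (begin
  scale b q ⊕ (p ⊗ (a ∷ q))             ≈⟨ ⊕-congʳ (scale b q) (⊗-∷ʳ p a q) ⟩
  scale b q ⊕ (scale a p ⊕ (0 ∷ p ⊗ q)) ≈⟨ ⊕-leftSwap (scale b q) (scale a p) _ ⟩
  scale a p ⊕ (scale b q ⊕ (0 ∷ p ⊗ q)) ∎)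
  where open ≈-Reasoning

⊗-comm : ∀ p q → p ⊗ q ≈ q ⊗ p
⊗-comm []      q = ≈-sym (⊗-zeroʳ q)
⊗-comm (a ∷ p) q =
  ≈-trans (⊕-congʳ (scale a q) (∷-cong refl (⊗-comm p q))) (≈-sym (⊗-∷ʳ q a p))

⊗-cong : ∀ {p p′ q q′} → p ≈ p′ → q ≈ q′ → p ⊗ q ≈ p′ ⊗ q′
⊗-cong {p} {p′} {q} {q′} p≈p′ q≈q′ = begin
  p ⊗ q    ≈⟨ ⊗-congʳ p q≈q′ ⟩
  p ⊗ q′   ≈⟨ ⊗-comm p q′ ⟩
  q′ ⊗ p   ≈⟨ ⊗-congʳ q′ p≈p′ ⟩
  q′ ⊗ p′  ≈⟨ ⊗-comm q′ p′ ⟩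
  p′ ⊗ q′  ∎
  where open ≈-Reasoning

⊗-distribʳ : ∀ p q r → (p ⊕ q) ⊗ r ≈ (p ⊗ r) ⊕ (q ⊗ r)
⊗-distribʳ []      q       r = ≈-refl
⊗-distribʳ (a ∷ p) []      r = ≈-sym (⊕-identityʳ ((a ∷ p) ⊗ r))
⊗-distribʳ (a ∷ p) (b ∷ q) r = begin
  scale (a + b) r ⊕ (0 ∷ (p ⊕ q) ⊗ r)
    ≈⟨ ⊕-cong (scale-distribʳ a b r) (∷-cong refl (⊗-distribʳ p q r)) ⟩
  (scale a r ⊕ scale b r) ⊕ ((0 ∷ p ⊗ r) ⊕ (0 ∷ q ⊗ r))
    ≈⟨ ⊕-interchange (scale a r) (scale b r) _ _ ⟩
  (scale a r ⊕ (0 ∷ p ⊗ r)) ⊕ (scale b r ⊕ (0 ∷ q ⊗ r))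
    ∎
  where open ≈-Reasoning

shiftX-⊗ : ∀ p q → shiftX p ⊗ q ≈ shiftX (p ⊗ q)
shiftX-⊗ p q = ⊕-congˡ (0 ∷ p ⊗ q) (scale-zero q)

scale-⊗ : ∀ c p q → scale c p ⊗ q ≈ scale c (p ⊗ q)
scale-⊗ c []      q = ≈-refl
scale-⊗ c (a ∷ p) q = begin
  scale (c * a) q ⊕ (0 ∷ scale c p ⊗ q)
    ≈⟨ ⊕-cong (scale-assoc c a q) (∷-cong (sym (*-zeroʳ c)) (scale-⊗ c p q)) ⟩
  scale c (scale a q) ⊕ scale c (0 ∷ p ⊗ q)
    ≈⟨ scale-distribˡ c (scale a q) (0 ∷ p ⊗ q) ⟨
  scale c (scale a q ⊕ (0 ∷ p ⊗ q))
    ∎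
  where open ≈-Reasoning

⊗-assoc : ∀ p q r → (p ⊗ q) ⊗ r ≈ p ⊗ (q ⊗ r)
⊗-assoc []      q r = ≈-refl
⊗-assoc (a ∷ p) q r = begin
  (scale a q ⊕ (0 ∷ p ⊗ q)) ⊗ r
    ≈⟨ ⊗-distribʳ (scale a q) (0 ∷ p ⊗ q) r ⟩
  (scale a q ⊗ r) ⊕ (shiftX (p ⊗ q) ⊗ r)
    ≈⟨ ⊕-cong (scale-⊗ a q r) (shiftX-⊗ (p ⊗ q) r) ⟩
  scale a (q ⊗ r) ⊕ (0 ∷ (p ⊗ q) ⊗ r)
    ≈⟨ ⊕-congʳ (scale a (q ⊗ r)) (∷-cong refl (⊗-assoc p q r)) ⟩
  scale a (q ⊗ r) ⊕ (0 ∷ p ⊗ (q ⊗ r))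
    ∎
  where open ≈-Reasoning

⊗-identityˡ : ∀ p → one ⊗ p ≈ p
⊗-identityˡ p = ≈-trans (⊕-cong (scale-identity p) (0∷-zero {[]} ≈-refl)) (⊕-identityʳ p)

⊗-commutativeSemigroup : CommutativeSemigroup 0ℓ 0ℓ
⊗-commutativeSemigroup = record
  { _≈_                    = _≈_
  ; _∙_                    = _⊗_
  ; isCommutativeSemigroup = record
    { isSemigroup = record
      { isMagma = record { isEquivalence = ≈-isEquivalence ; ∙-cong = ⊗-cong }
      ; assoc   = ⊗-assoc
      }
    ; comm = ⊗-comm
    }
  }

open CommutativeSemigroupProperties ⊗-commutativeSemigroup
  using () renaming (x∙yz≈y∙xz to ⊗-leftSwap)

-- Paths and their independence polynomials

-- Independence polynomial of a path with ℓ vertices (f_{ℓ+1}), or of the path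
-- that remains once its first vertex is blocked (f_ℓ).
chainGF : Bool → ℕ → Poly
chainGF false ℓ = fib (suc ℓ)
chainGF true  ℓ = fib ℓ

-- Product over the chains of the window F, the first r of which have L + 1
-- vertices left and the others L.
chainsGF : Vec Bool m → ℕ → ℕ → Poly
chainsGF []      L r       = one
chainsGF (b ∷ F) L zero    = chainGF b L ⊗ chainsGF F L zero
chainsGF (b ∷ F) L (suc r) = chainGF b (suc L) ⊗ chainsGF F L r

chainsGF-zero : (F : Vec Bool m) → chainsGF F 0 0 ≈ one
chainsGF-zero []          = ≈-refl
chainsGF-zero (false ∷ F) = ≈-trans (⊗-identityˡ _) (chainsGF-zero F)
chainsGF-zero (true ∷ F)  = ≈-trans (⊗-identityˡ _) (chainsGF-zero F)

chainsGF-full : (F : Vec Bool m) (L : ℕ) → chainsGF F L m ≡ chainsGF F (suc L) 0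
chainsGF-full []      L = refl
chainsGF-full (b ∷ F) L = cong (chainGF b (suc L) ⊗_) (chainsGF-full F L)

chainsGF-∷ʳ : (F : Vec Bool m) (c : Bool) (L r : ℕ) → r ≤ m →
              chainsGF (F ∷ʳ c) L r ≈ chainGF c L ⊗ chainsGF F L r
chainsGF-∷ʳ []      c L zero    _         = ≈-refl
chainsGF-∷ʳ (b ∷ F) c L zero    _         =
  ≈-trans (⊗-congʳ (chainGF b L) (chainsGF-∷ʳ F c L zero z≤n))
          (⊗-leftSwap (chainGF b L) (chainGF c L) _)
chainsGF-∷ʳ (b ∷ F) c L (suc r) (s≤s r≤m) =
  ≈-trans (⊗-congʳ (chainGF b (suc L)) (chainsGF-∷ʳ F c L r r≤m))
          (⊗-leftSwap (chainGF b (suc L)) (chainGF c L) _)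

chainsGF-replicate : (L m r : ℕ) → r ≤ m →
  chainsGF (replicate m false) L r ≈ (fib (suc L) ^ᴾ (m ∸ r)) ⊗ (fib (suc (suc L)) ^ᴾ r)
chainsGF-replicate L zero    zero    _         = ≈-sym (⊗-identityˡ one)
chainsGF-replicate L (suc m) zero    _         =
  ≈-trans (⊗-congʳ (fib (suc L)) (chainsGF-replicate L m zero z≤n))
          (≈-sym (⊗-assoc (fib (suc L)) (fib (suc L) ^ᴾ m) one))
chainsGF-replicate L (suc m) (suc r) (s≤s r≤m) =
  ≈-trans (⊗-congʳ (fib (suc (suc L))) (chainsGF-replicate L m r r≤m))
          (⊗-leftSwap (fib (suc (suc L))) (fib (suc L) ^ᴾ (m ∸ r)) _)

-- Scanning the positions from left to right

-- The window records, oldest first, which of the last m positions were chosen;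
-- the next position may be chosen only if the oldest one was not.
windowGF : Vec Bool (suc m) → ℕ → Poly
windowGF F       zero    = one
windowGF (b ∷ F) (suc n) =
  windowGF (F ∷ʳ false) n ⊕ (if b then [] else shiftX (windowGF (F ∷ʳ true) n))

admissible : Vec Bool (suc m) → Vec Bool n → Bool
admissible F       []          = true
admissible (b ∷ F) (false ∷ p) = admissible (F ∷ʳ false) p
admissible (b ∷ F) (true ∷ p)  = not b ∧ admissible (F ∷ʳ true) p

-- Leaving the next position out or choosing it is the recurrence f_{L+2} = f_{L+1} + x f_L.
windowGF-step : (b : Bool) (F : Vec Bool m) (n : ℕ) (X : Poly) (L : ℕ) →
  (∀ c → windowGF (F ∷ʳ c) n ≈ chainGF c L ⊗ X) →
  windowGF (b ∷ F) (suc n) ≈ chainGF b (suc L) ⊗ X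
windowGF-step true  F n X L ih = ≈-trans (⊕-identityʳ _) (ih false)
windowGF-step false F n X L ih = begin
  windowGF (F ∷ʳ false) n ⊕ shiftX (windowGF (F ∷ʳ true) n)
    ≈⟨ ⊕-cong (ih false) (∷-cong refl (ih true)) ⟩
  (fib (suc L) ⊗ X) ⊕ shiftX (fib L ⊗ X)
    ≈⟨ ⊕-congʳ (fib (suc L) ⊗ X) (shiftX-⊗ (fib L) X) ⟨
  (fib (suc L) ⊗ X) ⊕ (shiftX (fib L) ⊗ X)
    ≈⟨ ⊗-distribʳ (fib (suc L)) (shiftX (fib L)) X ⟨
  fib (suc (suc L)) ⊗ X
    ∎
  where open ≈-Reasoning

-- The length is written r + L * suc m so that both recursive calls unfold it definitionally.
windowGF-chainsGF : (F : Vec Bool (suc m)) (L r : ℕ) → r ≤ m →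
                    windowGF F (r + L * suc m) ≈ chainsGF F L r
windowGF-chainsGF F zero zero _ = ≈-sym (chainsGF-zero F)
windowGF-chainsGF {m} (b ∷ F) (suc L) zero _ =
  subst (windowGF (b ∷ F) (suc (m + L * suc m)) ≈_)
        (cong (chainGF b (suc L) ⊗_) (chainsGF-full F L))
        (windowGF-step b F (m + L * suc m) (chainsGF F L m) L λ c →
           ≈-trans (windowGF-chainsGF (F ∷ʳ c) L m ≤-refl) (chainsGF-∷ʳ F c L m ≤-refl))
windowGF-chainsGF {m} (b ∷ F) L (suc r) r<m =
  windowGF-step b F (r + L * suc m) (chainsGF F L r) L λ c →
    ≈-trans (windowGF-chainsGF (F ∷ʳ c) L r (<⇒≤ r<m))
            (chainsGF-∷ʳ F c L r (<⇒≤ r<m))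

-- Counting subsets

module _ {a ℓ} {A : Set a} {P : Pred A ℓ} (P? : Decidable P) where

  count : List A → ℕ
  count xs = length (filter P? xs)

  count-++ : ∀ xs ys → count (xs ++ ys) ≡ count xs + count ys
  count-++ xs ys = trans (cong length (filter-++ P? xs ys)) (length-++ (filter P? xs))

  count-map : ∀ {b} {B : Set b} (f : B → A) xs → count (map f xs) ≡ length (filter (P? ∘ f) xs)
  count-map f []       = refl
  count-map f (x ∷ xs) with does (P? (f x))
  ... | true  = cong suc (count-map f xs)
  ... | false = count-map f xs

  count-none : (∀ x → ¬ P x) → ∀ xs → count xs ≡ 0
  count-none ¬P xs = cong length (filter-none P? (universal ¬P xs))

count-≐ : ∀ {a ℓ₁ ℓ₂} {A : Set a} {P : Pred A ℓ₁} {Q : Pred A ℓ₂}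
          (P? : Decidable P) (Q? : Decidable Q) → P ≐ Q → ∀ xs → count P? xs ≡ count Q? xs
count-≐ P? Q? P≐Q xs = cong length (filter-≐ P? Q? P≐Q xs)

count-allSubsets : ∀ {ℓ} {P : Pred (Subset (suc n)) ℓ} (P? : Decidable P) →
  count P? (allSubsets (suc n)) ≡ count (P? ∘ (false ∷_)) (allSubsets n) + count (P? ∘ (true ∷_)) (allSubsets n)
count-allSubsets {n} P? =
  trans (count-++ P? (map (false ∷_) (allSubsets n)) (map (true ∷_) (allSubsets n)))
        (cong₂ _+_ (count-map P? (false ∷_) (allSubsets n)) (count-map P? (true ∷_) (allSubsets n)))

Admissible : ℕ → Vec Bool (suc m) → Pred (Subset n) 0ℓ
Admissible k F p = ∣ p ∣ ≡ k × T (admissible F p)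

admissible? : (k : ℕ) (F : Vec Bool (suc m)) → Decidable (Admissible {n = n} k F)
admissible? k F p = (∣ p ∣ ≟ k) ×-dec T? (admissible F p)

coeff-windowGF : (k : ℕ) (F : Vec Bool (suc m)) (n : ℕ) →
                 coeff k (windowGF F n) ≡ count (admissible? k F) (allSubsets n)
coeff-windowGF zero    F       zero    = refl
coeff-windowGF (suc k) F       zero    = refl
coeff-windowGF k       (b ∷ F) (suc n) = begin
  coeff k (windowGF (F ∷ʳ false) n ⊕ chosen b)
    ≡⟨ coeff-⊕ k (windowGF (F ∷ʳ false) n) (chosen b) ⟩
  coeff k (windowGF (F ∷ʳ false) n) + coeff k (chosen b)
    ≡⟨ cong₂ _+_ (coeff-windowGF k (F ∷ʳ false) n) (coeff-chosen b k) ⟩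
  count (admissible? k (F ∷ʳ false)) (allSubsets n) + count (admissible? k (b ∷ F) ∘ (true ∷_)) (allSubsets n)
    ≡⟨ count-allSubsets {n} (admissible? k (b ∷ F)) ⟨
  count (admissible? k (b ∷ F)) (allSubsets (suc n))
    ∎
  where
  open ≡-Reasoning

  chosen : Bool → Poly
  chosen b = if b then [] else shiftX (windowGF (F ∷ʳ true) n)

  coeff-chosen : ∀ b k → coeff k (chosen b) ≡ count (admissible? k (b ∷ F) ∘ (true ∷_)) (allSubsets n)
  coeff-chosen true  k       = sym (count-none _ (λ _ → proj₂) (allSubsets n))
  coeff-chosen false zero    = sym (count-none _ (λ _ ()) (allSubsets n))
  coeff-chosen false (suc k) =
    trans (coeff-windowGF k (F ∷ʳ true) n)
          (count-≐ _ _ (map₁ (cong suc) , map₁ suc-injective) (allSubsets n))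

-- What admissibility means

bit : Vec Bool n → ℕ → Bool
bit []      i       = false
bit (b ∷ p) zero    = b
bit (b ∷ p) (suc i) = bit p i

NoDiffᵇ : ℕ → Vec Bool n → Set
NoDiffᵇ m p = ∀ i → T (bit p i) → T (bit p (i + m)) → ⊥

Avoids : Vec Bool m → Vec Bool n → Set
Avoids F p = ∀ i → T (bit F i) → T (bit p i) → ⊥

-- F is the window just before p, so its i-th entry and the i-th position of p are
-- exactly as far apart as F is long.
Compatible : Vec Bool (suc m) → Vec Bool n → Set
Compatible {m} F p = NoDiffᵇ (suc m) p × Avoids F p

bit-∷ʳ-last : (F : Vec Bool m) (c : Bool) → bit (F ∷ʳ c) m ≡ c
bit-∷ʳ-last []      c = refl
bit-∷ʳ-last (b ∷ F) c = bit-∷ʳ-last F c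

bit-∷ʳ⁺ : (F : Vec Bool m) (c : Bool) (i : ℕ) → T (bit F i) → T (bit (F ∷ʳ c) i)
bit-∷ʳ⁺ (b ∷ F) c zero    t = t
bit-∷ʳ⁺ (b ∷ F) c (suc i) t = bit-∷ʳ⁺ F c i t

bit-∷ʳ⁻ : (F : Vec Bool m) (c : Bool) (i : ℕ) → T (bit (F ∷ʳ c) i) → T (bit F i) ⊎ (i ≡ m × T c)
bit-∷ʳ⁻ []      c zero    t = inj₂ (refl , t)
bit-∷ʳ⁻ (b ∷ F) c zero    t = inj₁ t
bit-∷ʳ⁻ (b ∷ F) c (suc i) t = map-⊎ id (map₁ (cong suc)) (bit-∷ʳ⁻ F c i t)

Compatible-∷ : {b c : Bool} {F : Vec Bool m} {p : Vec Bool n} →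
  Compatible (b ∷ F) (c ∷ p) ⇔ (¬ (T b × T c) × Compatible (F ∷ʳ c) p)
Compatible-∷ {m} {b = b} {c} {F} {p} = mk⇔ to from
  where
  to : Compatible (b ∷ F) (c ∷ p) → ¬ (T b × T c) × Compatible (F ∷ʳ c) p
  to (noDiff , avoids) =
    (λ (tb , tc) → avoids 0 tb tc) ,
    (λ i → noDiff (suc i)) ,
    (λ i tF tp → [ (λ tF′ → avoids (suc i) tF′ tp)
                 , (λ (i≡m , tc) → noDiff 0 tc (subst (T ∘ bit p) i≡m tp)) ]
                 (bit-∷ʳ⁻ F c i tF))
  from : ¬ (T b × T c) × Compatible (F ∷ʳ c) p → Compatible (b ∷ F) (c ∷ p)
  from (¬bc , noDiff , avoids) = noDiff′ , avoids′
    where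
    noDiff′ : NoDiffᵇ (suc m) (c ∷ p)
    noDiff′ zero    tc tp = avoids m (subst T (sym (bit-∷ʳ-last F c)) tc) tp
    noDiff′ (suc i)       = noDiff i
    avoids′ : Avoids (b ∷ F) (c ∷ p)
    avoids′ zero    tb tc = ¬bc (tb , tc)
    avoids′ (suc i) tF tp = avoids i (bit-∷ʳ⁺ F c i tF) tp

admissible⇒Compatible : (F : Vec Bool (suc m)) (p : Vec Bool n) → T (admissible F p) → Compatible F p
admissible⇒Compatible F           []          _  = (λ _ ()) , (λ _ _ ())
admissible⇒Compatible (b ∷ F)     (false ∷ p) ok =
  Equivalence.from Compatible-∷ (proj₂ , admissible⇒Compatible (F ∷ʳ false) p ok)
admissible⇒Compatible (false ∷ F) (true ∷ p)  ok =
  Equivalence.from Compatible-∷ (proj₁ , admissible⇒Compatible (F ∷ʳ true) p ok)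
admissible⇒Compatible (true ∷ F)  (true ∷ p)  ()

Compatible⇒admissible : (F : Vec Bool (suc m)) (p : Vec Bool n) → Compatible F p → T (admissible F p)
Compatible⇒admissible F           []          _ = _
Compatible⇒admissible (b ∷ F)     (false ∷ p) compatible =
  Compatible⇒admissible (F ∷ʳ false) p (proj₂ (Equivalence.to Compatible-∷ compatible))
Compatible⇒admissible (false ∷ F) (true ∷ p)  compatible =
  Compatible⇒admissible (F ∷ʳ true) p (proj₂ (Equivalence.to Compatible-∷ compatible))
Compatible⇒admissible (true ∷ F)  (true ∷ p)  compatible =
  proj₁ (Equivalence.to Compatible-∷ compatible) _

∈⇒bit : {p : Subset n} {x : Fin n} → x ∈ p → T (bit p (toℕ x))
∈⇒bit here        = _
∈⇒bit (there x∈p) = ∈⇒bit x∈p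

bit⇒∈ : (p : Subset n) (i : ℕ) → T (bit p i) → ∃[ x ] toℕ x ≡ i × x ∈ p
bit⇒∈ (true ∷ p) zero    _ = zero , refl , here
bit⇒∈ (b ∷ p)    (suc i) t with bit⇒∈ p i t
... | x , refl , x∈p = suc x , refl , there x∈p

NoDiff⇔NoDiffᵇ : (m : ℕ) (p : Subset n) → NoDiff m p ⇔ NoDiffᵇ m p
NoDiff⇔NoDiffᵇ m p = mk⇔ to from
  where
  to : NoDiff m p → NoDiffᵇ m p
  to noDiff i ti tj with bit⇒∈ p i ti | bit⇒∈ p (i + m) tj
  ... | x , refl , x∈p | y , y≡x+m , y∈p = noDiff x y x∈p y∈p y≡x+m
  from : NoDiffᵇ m p → NoDiff m p
  from noDiff x y x∈p y∈p y≡x+m = noDiff (toℕ x) (∈⇒bit x∈p) (subst (T ∘ bit p) y≡x+m (∈⇒bit y∈p))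

bit-replicate-false : (m i : ℕ) → ¬ T (bit (replicate m false) i)
bit-replicate-false zero    i       ()
bit-replicate-false (suc m) zero    ()
bit-replicate-false (suc m) (suc i) t = bit-replicate-false m i t

Good⇔Admissible : (m k : ℕ) (p : Subset n) → Good (suc m) k p ⇔ Admissible k (replicate (suc m) false) p
Good⇔Admissible m k p = mk⇔ (map₂ to) (map₂ from)
  where
  nothingChosen : Vec Bool (suc m)
  nothingChosen = replicate (suc m) false
  to : NoDiff (suc m) p → T (admissible nothingChosen p)
  to noDiff = Compatible⇒admissible nothingChosen p
    (Equivalence.to (NoDiff⇔NoDiffᵇ (suc m) p) noDiff , λ i t _ → bit-replicate-false (suc m) i t)
  from : T (admissible nothingChosen p) → NoDiff (suc m) p
  from ok = Equivalence.from (NoDiff⇔NoDiffᵇ (suc m) p) (proj₁ (admissible⇒Compatible nothingChosen p ok))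

S≡count-admissible : (m n k : ℕ) → S (suc m) n k ≡ count (admissible? k (replicate (suc m) false)) (allSubsets n)
S≡count-admissible m n k =
  count-≐ (good? (suc m) k) (admissible? k _)
    (Equivalence.to (Good⇔Admissible m k _) , Equivalence.from (Good⇔Admissible m k _))
    (allSubsets n)

corollary18 : (j m r k : ℕ) → m ≥ 1 → r < m →
    S m (m * j + r) k ≡ coeff k ((fib (j + 1) ^ᴾ (m ∸ r)) ⊗ (fib (j + 2) ^ᴾ r))
corollary18 j zero    r k () _
corollary18 j (suc m) r k _  (s≤s r≤m) = begin
  S (suc m) (suc m * j + r) k
    ≡⟨ cong (λ n → S (suc m) n k) (trans (+-comm (suc m * j) r) (cong (r +_) (*-comm (suc m) j))) ⟩
  S (suc m) (r + j * suc m) k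
    ≡⟨ S≡count-admissible m (r + j * suc m) k ⟩
  count (admissible? k nothingChosen) (allSubsets (r + j * suc m))
    ≡⟨ coeff-windowGF k nothingChosen (r + j * suc m) ⟨
  coeff k (windowGF nothingChosen (r + j * suc m))
    ≡⟨ windowGF-chainsGF nothingChosen j r r≤m .coeff≡ k ⟩
  coeff k (chainsGF nothingChosen j r)
    ≡⟨ chainsGF-replicate j (suc m) r (m≤n⇒m≤1+n r≤m) .coeff≡ k ⟩
  coeff k ((fib (suc j) ^ᴾ (suc m ∸ r)) ⊗ (fib (suc (suc j)) ^ᴾ r))
    ≡⟨ cong₂ (λ a b → coeff k ((fib a ^ᴾ (suc m ∸ r)) ⊗ (fib b ^ᴾ r))) (+-comm 1 j) (+-comm 2 j) ⟩
  coeff k ((fib (j + 1) ^ᴾ (suc m ∸ r)) ⊗ (fib (j + 2) ^ᴾ r))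
    ∎
  where
  open ≡-Reasoning
  nothingChosen : Vec Bool (suc m)
  nothingChosen = replicate (suc m) false
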